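{- For every Rec program $\langle S,T\rangle$, $[\![\mathsf{stf}_{\varnothing}(S)]\!] = \mathcal{S}_{tr}[\![S]\!]$.
   Context: Rec programs: a pair $\langle S,T\rangle$ with $S ::= \mathbf{skip} \mid x := a \mid S_1;S_2 \mid \mathbf{if}\ b\ \mathbf{then}\ S_1\ \mathbf{else}\ S_2 \mid m()$ and $T$ a finite list of declarations $m\,\{S_m\}$ of parameterless procedures with unique names; only declared procedures are called. $a$, $b$ are side-effect-free arithmetic/Boolean expressions over global integer variables; $\mathbf{State}$ = maps from variables to $\mathbb{Z}$; $\mathcal{A}[\![a]\!](s)$, $\mathcal{B}[\![b]\!](s)$ denote evaluation; $\mathbf{State}^+$ = nonempty finite state sequences. Trace semantics of Rec: for $A,B\subseteq\mathbf{State}^+$, $A|_b=\{s\cdot\sigma\in A:\mathcal{B}[\![b]\!](s)=\mathbf{tt}\}$, $\sharp A=\{s\cdot s\cdot\sigma:s\cdot\sigma\in A\}$, $A\frown B=\{\sigma_A\cdot s\cdot\sigma_B:\sigma_A\cdot s\in A, s\cdot\sigma_B\in B\}$. With procedures $m_1,\dots,m_n$ declared as $m_i\,\{S_i\}$ and $\rho$ mapping procedure names to trace sets: $\mathcal{S}_{tr}[\![\mathbf{skip}]\!]_\rho=\{s\cdot s\}$, $\mathcal{S}_{tr}[\![x:=a]\!]_\rho=\{s\cdot s[x\mapsto\mathcal{A}[\![a]\!](s)]\}$, sequencing is $\frown$, $\mathcal{S}_{tr}[\![\mathbf{if}\ b\ \mathbf{then}\ S_1\ \mathbf{else}\ S_2]\!]_\rho=(\sharp\mathcal{S}_{tr}[\![S_1]\!]_\rho)|_b\cup(\sharp\mathcal{S}_{tr}[\![S_2]\!]_\rho)|_{\neg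 b}$, $\mathcal{S}_{tr}[\![m_i()]\!]_\rho=\rho(m_i)$; $\rho_0$ is the least fixed point (pointwise inclusion) of $H(\rho)=(\sharp\mathcal{S}_{tr}[\![S_1]\!]_\rho,\dots,\sharp\mathcal{S}_{tr}[\![S_n]\!]_\rho)$ and $\mathcal{S}_{tr}[\![S]\!]=\mathcal{S}_{tr}[\![S]\!]_{\rho_0}$. Trace formulas: $\phi ::= p \mid R \mid X \mid \phi_1\wedge\phi_2 \mid \phi_1\vee\phi_2 \mid \phi_1\frown\phi_2 \mid \mu X.\phi$, with $p$ state formulas (including Boolean expressions), $R$ binary relation symbols, $X$ recursion variables. Semantics relative to a valuation $\mathcal{V}$: $[\![p]\!]=\{s\cdot\sigma:s\models p\}$, $[\![R]\!]=\{s\cdot s':R(s,s')\}$, $[\![X]\!]=\mathcal{V}(X)$, $\wedge,\vee$ as $\cap,\cup$, $\frown$ as the chop $A\frown B$ above, $[\![\mu X.\phi]\!]_{\mathcal{V}}=\bigcap\{\gamma:[\![\phi]\!]_{\mathcal{V}[X\mapsto\gamma]}\subseteq\gamma\}$; for closed formulas the valuation is irrelevant and omitted. Relation symbols used: $\mathit{Id}(s,s')$ iff $s'=s$; $\mathit{Sb}^a_x(s,s')$ iff $s'=s[x\mapsto\mathcal{A}[\![a]\!](s)]$. Strongest trace formula: for a set $\overline{X}$ of procedure names, $\mathsf{stf}_{\overline{X}}(\mathbf{skip})=\mathit{Id}$, $\mathsf{stf}_{\overline{X}}(x:=a)=\mathit{Sb}^a_x$, $\mathsf{stf}_{\overline{X}}(S_1;S_2)=\mathsf{stf}_{\overline{X}}(S_1)\frown\mathsf{stf}_{\overline{X}}(S_2)$,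 $\mathsf{stf}_{\overline{X}}(\mathbf{if}\ b\ \mathbf{then}\ S_1\ \mathbf{else}\ S_2)=(b\wedge(\mathit{Id}\frown\mathsf{stf}_{\overline{X}}(S_1)))\vee(\neg b\wedge(\mathit{Id}\frown\mathsf{stf}_{\overline{X}}(S_2)))$, and $\mathsf{stf}_{\overline{X}}(m())=\mathit{Id}\frown\mu X_m.\,\mathsf{stf}_{\overline{X}\cup\{m\}}(S_m)$ if $m\notin\overline{X}$ and $m\,\{S_m\}\in T$, and $\mathit{Id}\frown X_m$ otherwise, where $X_m$ is a recursion variable associated with $m$. -}

module Defs where

open import Level using (Level; Lift; lift; 0ℓ; _⊔_) renaming (suc to lsuc)
open import Data.Bool using (Bool; true; false; not; _∧_) renaming (if_then_else_ to ifᵇ_then_else_)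
open import Data.Nat using (ℕ; zero; suc)
import Data.Nat as ℕ
open import Data.Integer using (ℤ)
import Data.Integer as ℤ
open import Data.Fin using (Fin)
import Data.Fin as Fin
open import Data.Fin.Subset using (Subset; ⁅_⁆; _∪_; ⊥)
open import Data.Fin.Subset.Properties using (_∈?_)
open import Data.List using (List; [])
open import Data.List.NonEmpty using (List⁺; _∷_; _∷ʳ_; _++⁺_; head)
open import Data.Product using (Σ; ∃; _×_; _,_)
open import Data.Sum using (_⊎_)
open import Relation.Binary.PropositionalEquality using (_≡_)
open import Relation.Binary.Definitions using (DecidableEquality)
open import Relation.Nullary using (yes; no)
open import Relation.Nullary.Decidable using (⌊_⌋)

PVar : Set
PVar = ℕ

State : Set
State = PVar → ℤ

_[_↦_] : State → PVar → ℤ → State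
(s [ x ↦ v ]) y = ifᵇ ⌊ y ℕ.≟ x ⌋ then v else s y

data Aexp : Set where
  num  : ℤ → Aexp
  pvar : PVar → Aexp
  _⊕_  : Aexp → Aexp → Aexp
  _⊖_  : Aexp → Aexp → Aexp
  _⊛_  : Aexp → Aexp → Aexp

𝒜⟦_⟧ : Aexp → State → ℤ
𝒜⟦ num k ⟧ s = k
𝒜⟦ pvar x ⟧ s = s x
𝒜⟦ a₁ ⊕ a₂ ⟧ s = 𝒜⟦ a₁ ⟧ s ℤ.+ 𝒜⟦ a₂ ⟧ s
𝒜⟦ a₁ ⊖ a₂ ⟧ s = 𝒜⟦ a₁ ⟧ s ℤ.- 𝒜⟦ a₂ ⟧ s
𝒜⟦ a₁ ⊛ a₂ ⟧ s = 𝒜⟦ a₁ ⟧ s ℤ.* 𝒜⟦ a₂ ⟧ s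

data Bexp : Set where
  tt    : Bexp
  ff    : Bexp
  _≐_   : Aexp → Aexp → Bexp
  _≼_   : Aexp → Aexp → Bexp
  ¬ᵇ_   : Bexp → Bexp
  _∧ᵇ_  : Bexp → Bexp → Bexp

ℬ⟦_⟧ : Bexp → State → Bool
ℬ⟦ tt ⟧ s = true
ℬ⟦ ff ⟧ s = false
ℬ⟦ a₁ ≐ a₂ ⟧ s = ⌊ 𝒜⟦ a₁ ⟧ s ℤ.≟ 𝒜⟦ a₂ ⟧ s ⌋
ℬ⟦ a₁ ≼ a₂ ⟧ s = ⌊ 𝒜⟦ a₁ ⟧ s ℤ.≤? 𝒜⟦ a₂ ⟧ s ⌋
ℬ⟦ ¬ᵇ b ⟧ s = not (ℬ⟦ b ⟧ s)
ℬ⟦ b₁ ∧ᵇ b₂ ⟧ s = ℬ⟦ b₁ ⟧ s ∧ ℬ⟦ b₂ ⟧ s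

-- A program ⟨S,T⟩ is S : Stmt n together with T : Fin n → Stmt n
-- (procedure m has body T m); names are unique and only declared
-- procedures can be called, by construction.

data Stmt (n : ℕ) : Set where
  skip          : Stmt n
  _:=_          : PVar → Aexp → Stmt n
  _⨾_          : Stmt n → Stmt n → Stmt n
  if_then_else_ : Bexp → Stmt n → Stmt n → Stmt n
  call          : Fin n → Stmt n

Decls : ℕ → Set
Decls n = Fin n → Stmt n

Trace : Set
Trace = List⁺ State

TSet : (ℓ : Level) → Set (lsuc ℓ)
TSet ℓ = Trace → Set ℓ

_∣ᵇ_ : ∀ {ℓ : Level} → TSet ℓ → Bexp → TSet ℓ
_∣ᵇ_ {ℓ} A b t = A t × Lift ℓ (ℬ⟦ b ⟧ (head t) ≡ true)

♯ : ∀ {ℓ} → TSet ℓ → TSet ℓ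
♯ A t = Σ State λ s → Σ (List State) λ σ → (t ≡ s ∷ (s Data.List.∷ σ)) × A (s ∷ σ)

_⌢_ : ∀ {a b} → TSet a → TSet b → TSet (a ⊔ b)
(A ⌢ B) t = Σ (List State) λ σA → Σ State λ s → Σ (List State) λ σB →
              (t ≡ σA ++⁺ (s ∷ σB)) × A (σA ∷ʳ s) × B (s ∷ σB)

module _ {n : ℕ} where

  Str⟦_⟧⟨_⟩ : ∀ {ℓ} → Stmt n → (Fin n → TSet ℓ) → TSet ℓ
  Str⟦ skip ⟧⟨ ρ ⟩ t = Lift _ (Σ State λ s → t ≡ s ∷ (s Data.List.∷ []))
  Str⟦ x := a ⟧⟨ ρ ⟩ t =
    Lift _ (Σ State λ s → t ≡ s ∷ ((s [ x ↦ 𝒜⟦ a ⟧ s ]) Data.List.∷ []))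
  Str⟦ S₁ ⨾ S₂ ⟧⟨ ρ ⟩ = Str⟦ S₁ ⟧⟨ ρ ⟩ ⌢ Str⟦ S₂ ⟧⟨ ρ ⟩
  Str⟦ if b then S₁ else S₂ ⟧⟨ ρ ⟩ t =
    (♯ (Str⟦ S₁ ⟧⟨ ρ ⟩) ∣ᵇ b) t ⊎ (♯ (Str⟦ S₂ ⟧⟨ ρ ⟩) ∣ᵇ (¬ᵇ b)) t
  Str⟦ call m ⟧⟨ ρ ⟩ = ρ m

  H : ∀ {ℓ} → Decls n → (Fin n → TSet ℓ) → Fin n → TSet ℓ
  H T ρ m = ♯ (Str⟦ T m ⟧⟨ ρ ⟩)

  -- least fixed point of H w.r.t. pointwise inclusion: intersection of
  -- all pre-fixed points ρ (H ρ ⊆ ρ pointwise)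
  ρ₀ : Decls n → Fin n → TSet (lsuc 0ℓ)
  ρ₀ T m t = (ρ : Fin n → TSet 0ℓ) → (∀ m' t' → H T ρ m' t' → ρ m' t') → ρ m t

  Sₜᵣ⟦_⟧ : Decls n → Stmt n → TSet (lsuc 0ℓ)
  Sₜᵣ⟦ T ⟧ S = Str⟦ S ⟧⟨ ρ₀ T ⟩

data Formula (X : Set) : Set₁ where
  st    : (State → Set) → Formula X
  rel   : (State → State → Set) → Formula X
  var   : X → Formula X
  _∧ᶠ_  : Formula X → Formula X → Formula X
  _∨ᶠ_  : Formula X → Formula X → Formula X
  _⌢ᶠ_  : Formula X → Formula X → Formula X
  μ     : X → Formula X → Formula X

module FormulaSemantics {X : Set} (_≟X_ : DecidableEquality X) where

  Valuation : Set₁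
  Valuation = X → TSet 0ℓ

  _[_≔_] : Valuation → X → TSet 0ℓ → Valuation
  (V [ x ≔ γ ]) y with x ≟X y
  ... | yes _ = γ
  ... | no  _ = V y

  ⟦_⟧⟨_⟩ : Formula X → Valuation → TSet (lsuc 0ℓ)
  ⟦ st p ⟧⟨ V ⟩ t = Lift _ (p (head t))
  ⟦ rel R ⟧⟨ V ⟩ t = Lift _ (Σ State λ s → Σ State λ s' →
                     (t ≡ s ∷ (s' Data.List.∷ [])) × R s s')
  ⟦ var x ⟧⟨ V ⟩ t = Lift _ (V x t)
  ⟦ φ ∧ᶠ ψ ⟧⟨ V ⟩ t = ⟦ φ ⟧⟨ V ⟩ t × ⟦ ψ ⟧⟨ V ⟩ t
  ⟦ φ ∨ᶠ ψ ⟧⟨ V ⟩ t = ⟦ φ ⟧⟨ V ⟩ t ⊎ ⟦ ψ ⟧⟨ V ⟩ t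
  ⟦ φ ⌢ᶠ ψ ⟧⟨ V ⟩ = (⟦ φ ⟧⟨ V ⟩) ⌢ (⟦ ψ ⟧⟨ V ⟩)
  ⟦ μ x φ ⟧⟨ V ⟩ t = (γ : TSet 0ℓ) → (∀ t' → ⟦ φ ⟧⟨ V [ x ≔ γ ] ⟩ t' → γ t') → γ t

Idᶠ : ∀ {X} → Formula X
Idᶠ = rel (λ s s' → s' ≡ s)

Sbᶠ : ∀ {X} → Aexp → PVar → Formula X
Sbᶠ a x = rel (λ s s' → s' ≡ s [ x ↦ 𝒜⟦ a ⟧ s ])

bexpᶠ : ∀ {X} → Bexp → Formula X
bexpᶠ b = st (λ s → ℬ⟦ b ⟧ s ≡ true)

-- Strongest trace formula stf_X̄(S); recursion variable X_m is m itself.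
-- The extra ℕ argument is fuel = n - |X̄| (well-founded measure of the
-- paper's recursion); stf_∅ starts with fuel n, so the fuel-0 call
-- clause is only reached when X̄ is full, i.e. m ∈ X̄.

module _ {n : ℕ} (T : Decls n) where

  stf′ : ℕ → Subset n → Stmt n → Formula (Fin n)
  stf′ k X̄ skip = Idᶠ
  stf′ k X̄ (x := a) = Sbᶠ a x
  stf′ k X̄ (S₁ ⨾ S₂) = stf′ k X̄ S₁ ⌢ᶠ stf′ k X̄ S₂
  stf′ k X̄ (if b then S₁ else S₂) =
    (bexpᶠ b ∧ᶠ (Idᶠ ⌢ᶠ stf′ k X̄ S₁)) ∨ᶠ (bexpᶠ (¬ᵇ b) ∧ᶠ (Idᶠ ⌢ᶠ stf′ k X̄ S₂))
  stf′ zero X̄ (call m) = Idᶠ ⌢ᶠ var m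
  stf′ (suc k) X̄ (call m) with m ∈? X̄
  ... | yes _ = Idᶠ ⌢ᶠ var m
  ... | no  _ = Idᶠ ⌢ᶠ μ m (stf′ k (X̄ ∪ ⁅ m ⁆) (T m))

  stf∅ : Stmt n → Formula (Fin n)
  stf∅ = stf′ n ⊥

open FormulaSemantics public

{-# OPTIONS --safe #-}
-- The least fixed point ρ₀ coincides with the union ρω of the Kleene
-- approximants approx j = Hʲ(∅): Str⟦S⟧ is monotone in the environment, and
-- continuous since a trace uses only finitely many calls. Unlike ρ₀, which
-- quantifies over all environments and so lives in Set₁, ρω can be used to
-- instantiate the binder of a μ-formula.
--
-- Soundness, ⟦stf S⟧ ⊆ Str⟦S⟧⟨ρω⟩: instantiate each μ X_m. stf(S_m) at
-- Str⟦S_m⟧⟨ρω⟩, which is closed under stf(S_m). Completeness,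
-- Str⟦S⟧⟨approx j⟩ ⊆ ⟦stf S⟧, is by induction on j: if γ is closed under the
-- formula of the body of m, an inner induction on the depth puts all traces
-- of the body into γ, because the recursive calls of m inside the body are
-- read through X_m ↦ γ and are shallower.
module Submission where

open import Defs
open import Level using (0ℓ; lift; lower)
open import Data.Nat using (ℕ; zero; suc; _≤_; _<_; _+_; _⊔_; z≤n; s≤s)
open import Data.Nat.Properties using (≤-trans; <⇒≱; m≤m+n; +-monoʳ-<; n≤1+n; m≤m⊔n; m≤n⊔m)
open import Data.Fin using (Fin; _≟_)
open import Data.Fin.Subset using (Subset; _∈_; _∉_; _⊂_; ⁅_⁆; _∪_; ∣_∣; ⊤) renaming (⊥ to ∅ˢ)
open import Data.Fin.Subset.Properties
  using (_∈?_; p⊂q⇒∣p∣<∣q∣; ⊆⊤; ∈⊤; ∣⊤∣≡n; p⊆p∪q; x∈p∪q⁺; x∈p∪q⁻; x∈⁅x⁆; x∈⁅y⁆⇒x≡y; ∉⊥)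
open import Data.List using ([]; _∷_)
open import Data.List.NonEmpty using (_∷_)
open import Data.Product using (_,_)
open import Data.Sum using (inj₁; inj₂)
open import Function using (_∘_)
open import Function.Bundles using (_⇔_; mk⇔)
open import Relation.Binary.PropositionalEquality using (refl; sym; subst)
open import Relation.Nullary using (yes; no; contradiction)
open import Relation.Unary using (_⊆′_; ∅; ⋃)

♯-mono : ∀ {a b} {A : TSet a} {B : TSet b} → A ⊆′ B → ♯ A ⊆′ ♯ B
♯-mono A⊆B t (s , σ , t≡ssσ , a) = s , σ , t≡ssσ , A⊆B _ a

⌢-mono : ∀ {a a′ b b′} {A : TSet a} {A′ : TSet a′} {B : TSet b} {B′ : TSet b′} →
         A ⊆′ A′ → B ⊆′ B′ → (A ⌢ B) ⊆′ (A′ ⌢ B′)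
⌢-mono A⊆A′ B⊆B′ t (σA , s , σB , t≡ , a , b) = σA , s , σB , t≡ , A⊆A′ _ a , B⊆B′ _ b

∣ᵇ-mono : ∀ {a b} {A : TSet a} {B : TSet b} (c : Bexp) → A ⊆′ B → (A ∣ᵇ c) ⊆′ (B ∣ᵇ c)
∣ᵇ-mono c A⊆B t (a , lift h) = A⊆B t a , lift h

module _ {n : ℕ} where

  infix 4 _⊆̇_

  _⊆̇_ : ∀ {a b} → (Fin n → TSet a) → (Fin n → TSet b) → Set _
  ρ ⊆̇ ρ′ = ∀ m → ρ m ⊆′ ρ′ m

  Str-mono : ∀ {a b} {ρ : Fin n → TSet a} {ρ′ : Fin n → TSet b} →
             ρ ⊆̇ ρ′ → ∀ S → Str⟦ S ⟧⟨ ρ ⟩ ⊆′ Str⟦ S ⟧⟨ ρ′ ⟩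
  Str-mono ρ⊆ρ′ skip t (lift p) = lift p
  Str-mono ρ⊆ρ′ (x := a) t (lift p) = lift p
  Str-mono ρ⊆ρ′ (S₁ ⨾ S₂) = ⌢-mono (Str-mono ρ⊆ρ′ S₁) (Str-mono ρ⊆ρ′ S₂)
  Str-mono ρ⊆ρ′ (if b then S₁ else S₂) t (inj₁ p) =
    inj₁ (∣ᵇ-mono b (♯-mono (Str-mono ρ⊆ρ′ S₁)) t p)
  Str-mono ρ⊆ρ′ (if b then S₁ else S₂) t (inj₂ p) =
    inj₂ (∣ᵇ-mono (¬ᵇ b) (♯-mono (Str-mono ρ⊆ρ′ S₂)) t p)
  Str-mono ρ⊆ρ′ (call m) = ρ⊆ρ′ m

module Kleene {n : ℕ} (T : Decls n) where

  ρ₀-least : {ρ : Fin n → TSet 0ℓ} → H T ρ ⊆̇ ρ → ρ₀ T ⊆̇ ρ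
  ρ₀-least {ρ} ρ-closed m t r = r ρ ρ-closed

  ρ₀-closed : H T (ρ₀ T) ⊆̇ ρ₀ T
  ρ₀-closed m t h ρ ρ-closed = ρ-closed m t (♯-mono (Str-mono (ρ₀-least ρ-closed) (T m)) t h)

  approx : ℕ → Fin n → TSet 0ℓ
  approx zero m = ∅
  approx (suc j) = H T (approx j)

  approx-mono : ∀ {i j} → i ≤ j → approx i ⊆̇ approx j
  approx-mono z≤n m t ()
  approx-mono (s≤s i≤j) m = ♯-mono (Str-mono (approx-mono i≤j) (T m))

  approx⊆ρ₀ : ∀ j → approx j ⊆̇ ρ₀ T
  approx⊆ρ₀ zero m t ()
  approx⊆ρ₀ (suc j) m t h = ρ₀-closed m t (♯-mono (Str-mono (approx⊆ρ₀ j) (T m)) t h)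

  ρω : Fin n → TSet 0ℓ
  ρω m = ⋃ ℕ λ j → approx j m

  Str-continuous : ∀ S → Str⟦ S ⟧⟨ ρω ⟩ ⊆′ ⋃ ℕ (λ j → Str⟦ S ⟧⟨ approx j ⟩)
  Str-continuous skip t p = 0 , p
  Str-continuous (x := a) t p = 0 , p
  Str-continuous (S₁ ⨾ S₂) t (σA , s , σB , t≡ , p₁ , p₂)
    with Str-continuous S₁ _ p₁ | Str-continuous S₂ _ p₂
  ... | j₁ , q₁ | j₂ , q₂ =
    j₁ ⊔ j₂ , σA , s , σB , t≡ , Str-mono (approx-mono (m≤m⊔n j₁ j₂)) S₁ _ q₁
                               , Str-mono (approx-mono (m≤n⊔m j₁ j₂)) S₂ _ q₂
  Str-continuous (if b then S₁ else S₂) t (inj₁ ((s , σ , t≡ , p) , h))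
    with Str-continuous S₁ _ p
  ... | j , q = j , inj₁ ((s , σ , t≡ , q) , h)
  Str-continuous (if b then S₁ else S₂) t (inj₂ ((s , σ , t≡ , p) , h))
    with Str-continuous S₂ _ p
  ... | j , q = j , inj₂ ((s , σ , t≡ , q) , h)
  Str-continuous (call m) t p = p

  ρω-closed : H T ρω ⊆̇ ρω
  ρω-closed m t (s , σ , t≡ , p) with Str-continuous (T m) _ p
  ... | j , q = suc j , s , σ , t≡ , q

  ρ₀⊆ρω : ρ₀ T ⊆̇ ρω
  ρ₀⊆ρω = ρ₀-least ρω-closed

  ρω⊆ρ₀ : ρω ⊆̇ ρ₀ T
  ρω⊆ρ₀ m t (j , p) = approx⊆ρ₀ j m t p

module _ {n : ℕ} where

  Fuel : ℕ → Subset n → Set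
  Fuel k X̄ = n ≤ k + ∣ X̄ ∣

  fuel-initial : Fuel n ∅ˢ
  fuel-initial = m≤m+n n _

  x∉p⇒∣p∣<n : ∀ {x : Fin n} {p : Subset n} → x ∉ p → ∣ p ∣ < n
  x∉p⇒∣p∣<n {x} {p} x∉p = subst (∣ p ∣ <_) (∣⊤∣≡n n) (p⊂q⇒∣p∣<∣q∣ {q = ⊤} (⊆⊤ , x , ∈⊤ , x∉p))

  fuel-exhausted : ∀ {X̄ : Subset n} → Fuel 0 X̄ → ∀ m → m ∈ X̄
  fuel-exhausted {X̄} fuel m with m ∈? X̄
  ... | yes m∈X̄ = m∈X̄
  ... | no m∉X̄ = contradiction fuel (<⇒≱ (x∉p⇒∣p∣<n m∉X̄))

  fuel-step : ∀ {k} {X̄ : Subset n} {m} → Fuel (suc k) X̄ → m ∉ X̄ → Fuel k (X̄ ∪ ⁅ m ⁆)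
  fuel-step {k} {X̄} {m} fuel m∉X̄ =
    ≤-trans fuel (+-monoʳ-< k (p⊂q⇒∣p∣<∣q∣ X̄⊂X̄∪⁅m⁆))
    where
      X̄⊂X̄∪⁅m⁆ : X̄ ⊂ X̄ ∪ ⁅ m ⁆
      X̄⊂X̄∪⁅m⁆ = p⊆p∪q ⁅ m ⁆ , m , x∈p∪q⁺ (inj₂ (x∈⁅x⁆ m)) , m∉X̄

module Formulas {n : ℕ} where

  module F = FormulaSemantics {Fin n} _≟_

  Id⌢⊆♯ : ∀ {a} {A : TSet a} V → (F.⟦ Idᶠ ⟧⟨ V ⟩ ⌢ A) ⊆′ ♯ A
  Id⌢⊆♯ V t ((_ ∷ []) , s , σ , t≡ , lift (_ , _ , refl , refl) , a) = s , σ , t≡ , a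
  Id⌢⊆♯ V t ([] , _ , _ , _ , lift (_ , _ , () , _) , _)
  Id⌢⊆♯ V t ((_ ∷ _ ∷ []) , _ , _ , _ , lift (_ , _ , () , _) , _)
  Id⌢⊆♯ V t ((_ ∷ _ ∷ _ ∷ _) , _ , _ , _ , lift (_ , _ , () , _) , _)

  ♯⊆Id⌢ : ∀ {a} {A : TSet a} V → ♯ A ⊆′ (F.⟦ Idᶠ ⟧⟨ V ⟩ ⌢ A)
  ♯⊆Id⌢ V t (s , σ , t≡ , a) = (s ∷ []) , s , σ , t≡ , lift (s , s , refl , refl) , a

  update-∪⁅⁆ : ∀ {ℓ} (P : Fin n → TSet 0ℓ → Set ℓ) {X̄ : Subset n} {V : F.Valuation} {m γ} →
               (∀ m′ → m′ ∈ X̄ → P m′ (V m′)) → P m γ →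
               ∀ m′ → m′ ∈ X̄ ∪ ⁅ m ⁆ → P m′ ((V F.[ m ≔ γ ]) m′)
  update-∪⁅⁆ P {X̄} {m = m} old new m′ m′∈ with m ≟ m′
  ... | yes refl = new
  ... | no m≢m′ with x∈p∪q⁻ X̄ ⁅ m ⁆ m′∈
  ...   | inj₁ m′∈X̄ = old m′ m′∈X̄
  ...   | inj₂ m′∈⁅m⁆ = contradiction (sym (x∈⁅y⁆⇒x≡y m m′∈⁅m⁆)) m≢m′

module Soundness {n : ℕ} (T : Decls n) (ρ : Fin n → TSet 0ℓ) (ρ-closed : H T ρ ⊆̇ ρ) where

  open Formulas {n}

  call-sound : ∀ {a} {A : TSet a} V m → A ⊆′ Str⟦ T m ⟧⟨ ρ ⟩ → (F.⟦ Idᶠ ⟧⟨ V ⟩ ⌢ A) ⊆′ ρ m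
  call-sound V m A⊆ t p = ρ-closed m t (♯-mono A⊆ t (Id⌢⊆♯ V t p))

  stf-sound : ∀ k X̄ S {V} → Fuel k X̄ → (∀ m → m ∈ X̄ → V m ⊆′ Str⟦ T m ⟧⟨ ρ ⟩) →
              F.⟦ stf′ T k X̄ S ⟧⟨ V ⟩ ⊆′ Str⟦ S ⟧⟨ ρ ⟩
  stf-sound k X̄ skip fuel V⊆ t (lift (s , _ , t≡ , refl)) = lift (s , t≡)
  stf-sound k X̄ (x := a) fuel V⊆ t (lift (s , _ , t≡ , refl)) = lift (s , t≡)
  stf-sound k X̄ (S₁ ⨾ S₂) fuel V⊆ = ⌢-mono (stf-sound k X̄ S₁ fuel V⊆) (stf-sound k X̄ S₂ fuel V⊆)
  stf-sound k X̄ (if b then S₁ else S₂) {V} fuel V⊆ t (inj₁ (lift hb , p)) =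
    inj₁ (♯-mono (stf-sound k X̄ S₁ fuel V⊆) t (Id⌢⊆♯ V t p) , lift hb)
  stf-sound k X̄ (if b then S₁ else S₂) {V} fuel V⊆ t (inj₂ (lift hb , p)) =
    inj₂ (♯-mono (stf-sound k X̄ S₂ fuel V⊆) t (Id⌢⊆♯ V t p) , lift hb)
  stf-sound zero X̄ (call m) {V} fuel V⊆ =
    call-sound V m (λ t → V⊆ m (fuel-exhausted fuel m) t ∘ lower)
  stf-sound (suc k) X̄ (call m) {V} fuel V⊆ with m ∈? X̄
  ... | yes m∈X̄ = call-sound V m (λ t → V⊆ m m∈X̄ t ∘ lower)
  ... | no m∉X̄ = call-sound V m λ t μ-body → μ-body (Str⟦ T m ⟧⟨ ρ ⟩)
          (stf-sound k (X̄ ∪ ⁅ m ⁆) (T m) (fuel-step fuel m∉X̄)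
            (update-∪⁅⁆ (λ m′ A → A ⊆′ Str⟦ T m′ ⟧⟨ ρ ⟩) V⊆ (λ _ a → a)))

module Completeness {n : ℕ} (T : Decls n) where

  open Kleene T
  open Formulas {n}

  Covers : ℕ → Subset n → F.Valuation → Set
  Covers j X̄ V = ∀ m → m ∈ X̄ → approx j m ⊆′ ♯ (V m)

  Covers-mono : ∀ {i j X̄ V} → i ≤ j → Covers j X̄ V → Covers i X̄ V
  Covers-mono i≤j cov m m∈X̄ t = cov m m∈X̄ t ∘ approx-mono i≤j m t

  mutual
    stf-complete : ∀ j k X̄ S {V} → Fuel k X̄ → Covers j X̄ V →
                   Str⟦ S ⟧⟨ approx j ⟩ ⊆′ F.⟦ stf′ T k X̄ S ⟧⟨ V ⟩
    stf-complete j k X̄ skip fuel cov t (lift (s , t≡)) = lift (s , s , t≡ , refl)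
    stf-complete j k X̄ (x := a) fuel cov t (lift (s , t≡)) = lift (s , _ , t≡ , refl)
    stf-complete j k X̄ (S₁ ⨾ S₂) fuel cov =
      ⌢-mono (stf-complete j k X̄ S₁ fuel cov) (stf-complete j k X̄ S₂ fuel cov)
    stf-complete j k X̄ (if b then S₁ else S₂) {V} fuel cov t (inj₁ (p , lift hb)) =
      inj₁ (lift hb , ♯⊆Id⌢ V t (♯-mono (stf-complete j k X̄ S₁ fuel cov) t p))
    stf-complete j k X̄ (if b then S₁ else S₂) {V} fuel cov t (inj₂ (p , lift hb)) =
      inj₂ (lift hb , ♯⊆Id⌢ V t (♯-mono (stf-complete j k X̄ S₂ fuel cov) t p))
    stf-complete j zero X̄ (call m) {V} fuel cov t p =
      ♯⊆Id⌢ V t (♯-mono (λ _ → lift) t (cov m (fuel-exhausted fuel m) t p))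
    stf-complete j (suc k) X̄ (call m) {V} fuel cov t p with m ∈? X̄
    ... | yes m∈X̄ = ♯⊆Id⌢ V t (♯-mono (λ _ → lift) t (cov m m∈X̄ t p))
    stf-complete (suc i) (suc k) X̄ (call m) {V} fuel cov t p | no m∉X̄ =
      ♯⊆Id⌢ V t (♯-mono (λ t′ q γ γ-closed →
                           unfolding-complete i fuel m∉X̄ cov γ γ-closed t′ q) t p)

    unfolding-complete : ∀ i {k X̄ V m} → Fuel (suc k) X̄ → m ∉ X̄ → Covers (suc i) X̄ V →
                         (γ : TSet 0ℓ) → F.⟦ stf′ T k (X̄ ∪ ⁅ m ⁆) (T m) ⟧⟨ V F.[ m ≔ γ ] ⟩ ⊆′ γ →
                         Str⟦ T m ⟧⟨ approx i ⟩ ⊆′ γ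
    unfolding-complete i {k} {X̄} {V} {m} fuel m∉X̄ cov γ γ-closed t p =
      γ-closed t (stf-complete i k (X̄ ∪ ⁅ m ⁆) (T m) (fuel-step fuel m∉X̄)
        (update-∪⁅⁆ (λ m′ A → approx i m′ ⊆′ ♯ A) (Covers-mono (n≤1+n i) cov)
                    (recursive-calls i cov)) t p)
      where
        recursive-calls : ∀ i′ → Covers (suc i′) X̄ V → approx i′ m ⊆′ ♯ γ
        recursive-calls zero cov′ t ()
        recursive-calls (suc i′) cov′ =
          ♯-mono (unfolding-complete i′ fuel m∉X̄ (Covers-mono (n≤1+n (suc i′)) cov′) γ γ-closed)

mainTheorem3 : (n : ℕ) (T : Decls n) (S : Stmt n)
    (V : Fin n → TSet 0ℓ) (t : Trace) →
    (⟦_⟧⟨_⟩ _≟_ (stf∅ T S) V t) ⇔ (Sₜᵣ⟦ T ⟧ S t)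
mainTheorem3 n T S V t = mk⇔ sound complete
  where
    open Kleene T
    open Soundness T ρω ρω-closed
    open Completeness T

    sound : ⟦_⟧⟨_⟩ _≟_ (stf∅ T S) V t → Sₜᵣ⟦ T ⟧ S t
    nothing-bound : ∀ {ℓ} {P : Fin n → Set ℓ} m → m ∈ ∅ˢ → P m
    nothing-bound m m∈∅ = contradiction m∈∅ ∉⊥

    sound f = Str-mono ρω⊆ρ₀ S t (stf-sound n ∅ˢ S fuel-initial nothing-bound t f)

    complete : Sₜᵣ⟦ T ⟧ S t → ⟦_⟧⟨_⟩ _≟_ (stf∅ T S) V t
    complete p with Str-continuous S t (Str-mono ρ₀⊆ρω S t p)
    ... | j , q = stf-complete j n ∅ˢ S fuel-initial nothing-bound t q
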